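{- Let $m,n\ge 1$. Then $TTr(K_{m,n})=1$ if $m=n=1$, and $TTr(K_{m,n})=2$ otherwise.
   Context: All graphs are finite and simple; $K_{m,n}$ is the complete bipartite graph with parts of sizes $m$ and $n$. For disjoint vertex sets $A,B$, $A$ dominates $B$ if every vertex of $B$ has a neighbour in $A$. A tournament transitive partition of order $k$ of $G=(V,E)$ is a partition $\{V_1,\dots,V_k\}$ of $V$ into nonempty sets such that for all $1\le i<j\le k$, $V_i$ dominates $V_j$ and $V_j$ does not dominate $V_i$. The tournament transitivity $TTr(G)$ is the maximum $k$ for which such a partition exists. -}

module Defs where

open import Data.Nat using (ℕ; _≤_)
open import Data.Fin using (Fin; _<_)
open import Data.Sum using (_⊎_; inj₁; inj₂)
open import Data.Product using (_×_; ∃-syntax)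
open import Data.Unit using (⊤)
open import Data.Empty using (⊥)
open import Relation.Nullary using (¬_)
open import Relation.Binary.PropositionalEquality using (_≡_)

record Graph (V : Set) : Set₁ where
  field
    Adj   : V → V → Set
    sym   : ∀ {x y} → Adj x y → Adj y x
    irrfl : ∀ {x} → ¬ Adj x x
open Graph public

KAdj : ∀ {m n} → Fin m ⊎ Fin n → Fin m ⊎ Fin n → Set
KAdj (inj₁ _) (inj₁ _) = ⊥
KAdj (inj₁ _) (inj₂ _) = ⊤
KAdj (inj₂ _) (inj₁ _) = ⊤
KAdj (inj₂ _) (inj₂ _) = ⊥

KAdj-sym : ∀ {m n} {x y : Fin m ⊎ Fin n} → KAdj x y → KAdj y x
KAdj-sym {x = inj₁ _} {inj₂ _} t = t
KAdj-sym {x = inj₂ _} {inj₁ _} t = t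

KAdj-irr : ∀ {m n} {x : Fin m ⊎ Fin n} → ¬ KAdj x x
KAdj-irr {x = inj₁ _} ()
KAdj-irr {x = inj₂ _} ()

K : (m n : ℕ) → Graph (Fin m ⊎ Fin n)
K m n = record { Adj = KAdj ; sym = KAdj-sym ; irrfl = KAdj-irr }

module _ {V : Set} (G : Graph V) where

  -- A partition of V into k labelled classes is a map V → Fin k;
  -- class i is the preimage of i.
  -- A = class i dominates B = class j: every vertex of B has a neighbour in A.
  Dominates : ∀ {k} → (V → Fin k) → Fin k → Fin k → Set
  Dominates f i j = ∀ y → f y ≡ j → ∃[ x ] (f x ≡ i × Adj G x y)

  record TTPartition (k : ℕ) : Set where
    field
      part     : V → Fin k
      nonempty : ∀ i → ∃[ x ] (part x ≡ i)
      dom      : ∀ i j → i < j → Dominates part i j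
      notDom   : ∀ i j → i < j → ¬ Dominates part j i

  IsTTr : ℕ → Set
  IsTTr t = TTPartition t × (∀ k → TTPartition k → k ≤ t)

{-# OPTIONS --safe #-}
-- In K_{m,n} every vertex is adjacent to one of the two ends of any edge, so a
-- class containing an edge dominates every class; in a tournament transitive
-- partition the classes after the first are therefore independent.  If class i
-- dominates a later class j through an edge x ∼ y and class i holds no neighbour
-- of x, then class i lies on the side of x and y dominates it back, which is
-- forbidden.  For i = 1, j = 2 this follows from the independence of class 1,
-- so TTr ≤ 2; in K_{1,1}, with i = 0, j = 1, it holds because y is the only
-- neighbour of x.  Conversely, isolating a vertex of a side with at least two
-- vertices yields a partition of order 2.
module Submission where

open import Defs
open import Data.Nat using (ℕ; _≤_; zero; suc; z≤n; s≤s)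
open import Data.Nat.Properties using (≤-refl)
open import Data.Fin using (Fin; zero; suc; _<_)
open import Data.Fin.Properties using (_≟_)
open import Data.Sum using (_⊎_; inj₁; inj₂)
open import Data.Sum.Properties using (≡-dec)
open import Data.Product using (_×_; _,_)
open import Data.Unit using (tt)
open import Data.Empty using (⊥-elim)
open import Relation.Nullary using (¬_; yes; no)
open import Relation.Binary.Definitions using (DecidableEquality)
open import Relation.Binary.PropositionalEquality
  using (_≡_; _≢_; refl; trans; subst) renaming (sym to ≡-sym)

module _ {V : Set} (G : Graph V) where

  trivial-partition : V → TTPartition G 1
  trivial-partition v = record
    { part     = λ _ → zero
    ; nonempty = λ { zero → v , refl }
    ; dom      = λ { zero zero () }
    ; notDom   = λ { zero zero () }
    }

  module _ (_≟ᵥ_ : DecidableEquality V) (v : V) where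

    isolate : V → Fin 2
    isolate x with x ≟ᵥ v
    ... | yes _ = suc zero
    ... | no  _ = zero

    isolate-self : isolate v ≡ suc zero
    isolate-self with v ≟ᵥ v
    ... | yes _  = refl
    ... | no v≢v = ⊥-elim (v≢v refl)

    isolate-other : ∀ {x} → x ≢ v → isolate x ≡ zero
    isolate-other {x} x≢v with x ≟ᵥ v
    ... | yes x≡v = ⊥-elim (x≢v x≡v)
    ... | no  _   = refl

    isolate⁻¹-self : ∀ {x} → isolate x ≡ suc zero → x ≡ v
    isolate⁻¹-self {x} x∈1 with x ≟ᵥ v
    ... | yes x≡v = x≡v
    isolate⁻¹-self {x} () | no _

    singleton-partition : ∀ {u w} → Adj G u v → ¬ Adj G v w → w ≢ v →
                          TTPartition G 2
    singleton-partition {u} {w} u∼v v≁w w≢v = record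
      { part     = isolate
      ; nonempty = λ { zero → u , isolate-other u≢v ; (suc zero) → v , isolate-self }
      ; dom      = λ { zero (suc zero) _ → dominated ; (suc zero) (suc zero) (s≤s ()) }
      ; notDom   = λ { zero (suc zero) _ → undominated ; (suc zero) (suc zero) (s≤s ()) }
      }
      where
      u≢v : u ≢ v
      u≢v refl = irrfl G u∼v

      dominated : Dominates G isolate zero (suc zero)
      dominated y y∈1 = u , isolate-other u≢v , subst (Adj G u) (≡-sym (isolate⁻¹-self y∈1)) u∼v

      undominated : ¬ Dominates G isolate (suc zero) zero
      undominated D with D w (isolate-other w≢v)
      ... | x , x∈1 , x∼w = v≁w (subst (λ x → Adj G x w) (isolate⁻¹-self x∈1) x∼w)

module _ {m n : ℕ} where

  KAdj-cover : {x y : Fin m ⊎ Fin n} → KAdj x y → ∀ z → KAdj x z ⊎ KAdj y z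
  KAdj-cover {inj₁ _} {inj₂ _} _ (inj₁ _) = inj₂ tt
  KAdj-cover {inj₁ _} {inj₂ _} _ (inj₂ _) = inj₁ tt
  KAdj-cover {inj₂ _} {inj₁ _} _ (inj₁ _) = inj₁ tt
  KAdj-cover {inj₂ _} {inj₁ _} _ (inj₂ _) = inj₂ tt

  module _ {k : ℕ} (part : Fin m ⊎ Fin n → Fin k) where

    NoNeighbourIn : Fin k → Fin m ⊎ Fin n → Set
    NoNeighbourIn i x = ∀ z → part z ≡ i → ¬ KAdj x z

    edge-dominates : ∀ {c x y} → part x ≡ c → part y ≡ c → KAdj x y →
                     ∀ d → Dominates (K m n) part c d
    edge-dominates {x = x} {y} x∈c y∈c x∼y d z _ with KAdj-cover x∼y z
    ... | inj₁ x∼z = x , x∈c , x∼z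
    ... | inj₂ y∼z = y , y∈c , y∼z

    dominated-by-neighbour : ∀ {i j x y} → KAdj x y → part y ≡ j →
                             NoNeighbourIn i x → Dominates (K m n) part j i
    dominated-by-neighbour {y = y} x∼y y∈j x≁i z z∈i with KAdj-cover x∼y z
    ... | inj₁ x∼z = ⊥-elim (x≁i z z∈i x∼z)
    ... | inj₂ y∼z = y , y∈j , y∼z

  module _ {k : ℕ} (P : TTPartition (K m n) k) where
    open TTPartition P

    later-class-independent : ∀ {i j x z} → i < j → part x ≡ j → part z ≡ j → ¬ KAdj x z
    later-class-independent {i} i<j x∈j z∈j x∼z =
      notDom i _ i<j (edge-dominates part x∈j z∈j x∼z i)

    earlier-class-meets-neighbour : ∀ {i j} → i < j →
      ¬ (∀ {x y} → part x ≡ i → part y ≡ j → KAdj x y → NoNeighbourIn part i x)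
    earlier-class-meets-neighbour {i} {j} i<j no-neighbour with nonempty j
    ... | y , y∈j with dom i j i<j y y∈j
    ... | x , x∈i , x∼y =
      notDom i j i<j (dominated-by-neighbour part x∼y y∈j (no-neighbour x∈i y∈j x∼y))

  K-order≤2 : ∀ {k} → TTPartition (K m n) k → k ≤ 2
  K-order≤2 {zero}               _ = z≤n
  K-order≤2 {suc zero}           _ = s≤s z≤n
  K-order≤2 {suc (suc zero)}     _ = ≤-refl
  K-order≤2 {suc (suc (suc k))} P = ⊥-elim (earlier-class-meets-neighbour P 1<2 class₁-no-neighbour)
    where
    open TTPartition P
    c₀ c₁ c₂ : Fin (suc (suc (suc k)))
    c₀ = zero
    c₁ = suc zero
    c₂ = suc (suc zero)
    0<1 : c₀ < c₁
    0<1 = s≤s z≤n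
    1<2 : c₁ < c₂
    1<2 = s≤s (s≤s z≤n)
    class₁-no-neighbour : ∀ {x y} → part x ≡ c₁ → part y ≡ c₂ → KAdj x y → NoNeighbourIn part c₁ x
    class₁-no-neighbour x∈1 _ _ z z∈1 = later-class-independent P 0<1 x∈1 z∈1

KAdj₁₁-unique : {x y z : Fin 1 ⊎ Fin 1} → KAdj x y → KAdj x z → y ≡ z
KAdj₁₁-unique {inj₁ _} {inj₂ zero} {inj₂ zero} _ _ = refl
KAdj₁₁-unique {inj₂ _} {inj₁ zero} {inj₁ zero} _ _ = refl

K₁₁-order≤1 : ∀ {k} → TTPartition (K 1 1) k → k ≤ 1
K₁₁-order≤1 {zero}        _ = z≤n
K₁₁-order≤1 {suc zero}    _ = ≤-refl
K₁₁-order≤1 {suc (suc k)} P = ⊥-elim (earlier-class-meets-neighbour P (s≤s z≤n) class₀-no-neighbour)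
  where
  open TTPartition P
  class₀-no-neighbour : ∀ {x y} → part x ≡ zero → part y ≡ suc zero → KAdj x y →
                        NoNeighbourIn part zero x
  class₀-no-neighbour _ y∈1 x∼y z z∈0 x∼z with KAdj₁₁-unique x∼y x∼z
  ... | refl with trans (≡-sym z∈0) y∈1
  ...   | ()

K-order-2-partition : ∀ m n → 1 ≤ m → 1 ≤ n → ¬ (m ≡ 1 × n ≡ 1) → TTPartition (K m n) 2
K-order-2-partition (suc (suc m)) (suc n) _ _ _ =
  singleton-partition (K _ _) (≡-dec _≟_ _≟_) (inj₁ zero)
    {u = inj₂ zero} {w = inj₁ (suc zero)} tt (λ ()) λ ()
K-order-2-partition (suc zero) (suc (suc n)) _ _ _ =
  singleton-partition (K _ _) (≡-dec _≟_ _≟_) (inj₂ zero)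
    {u = inj₁ zero} {w = inj₂ (suc zero)} tt (λ ()) λ ()
K-order-2-partition (suc zero) (suc zero) _ _ ¬K₁₁ = ⊥-elim (¬K₁₁ (refl , refl))

proposition10 : (m n : ℕ) → 1 ≤ m → 1 ≤ n →
    ((m ≡ 1 × n ≡ 1) → IsTTr (K m n) 1) × (¬ (m ≡ 1 × n ≡ 1) → IsTTr (K m n) 2)
proposition10 m n 1≤m 1≤n = K₁₁-TTr , other-TTr
  where
  K₁₁-TTr : (m ≡ 1 × n ≡ 1) → IsTTr (K m n) 1
  K₁₁-TTr (refl , refl) = trivial-partition (K 1 1) (inj₁ zero) , λ _ → K₁₁-order≤1

  other-TTr : ¬ (m ≡ 1 × n ≡ 1) → IsTTr (K m n) 2
  other-TTr ¬K₁₁ = K-order-2-partition m n 1≤m 1≤n ¬K₁₁ , λ _ → K-order≤2
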